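{- Let $H$ be a graph with binary chromatic number $\chi_B(H)=k+1$. Let $c_{\min}$ be the least integer $c\in\{0,\dots,k\}$ such that $V(H)$ cannot be partitioned into $c$ cliques and $k-c$ cocliques, and let $c_{\max}$ be the greatest such integer. If $c_{\min}\le k/2\le c_{\max}$, then $$\mathrm{Dist}(n,\mathrm{Forb}(n,H))\le \frac{1}{2k}\binom{n}{2}.$$ Otherwise, letting $c_0$ be the one of $c_{\min},c_{\max}$ that is closest to $k/2$, $$\mathrm{Dist}(n,\mathrm{Forb}(n,H))\le \left(\frac{1}{1+2\sqrt{\frac{c_0}{k}\left(1-\frac{c_0}{k}\right)}}\right)\frac{1}{k}\binom{n}{2}\le \frac{1}{k}\binom{n}{2}.$$
   Context: An edge-operation on a graph is the deletion of an existing edge or the addition of a non-existing edge. For graphs $G,G'$ on the same number of vertices, $\mathrm{Dist}(G,G')=\min\{|E(G)\,\Delta\, E(G'')| : G''\cong G',\ V(G'')=V(G)\}$. For a family $\mathcal H$ of $n$-vertex graphs, $\mathrm{Dist}(G,\mathcal H)=\min_{H'\in\mathcal H}\mathrm{Dist}(G,H')$ and $\mathrm{Dist}(n,\mathcal H)=\max\{\mathrm{Dist}(G,\mathcal H): |V(G)|=n\}$. $\mathrm{Forb}(n,H)$ is the set of all graphs on $n$ vertices with no induced subgraph isomorphic to $H$. A clique is a vertex set inducing a complete graph, a coclique a vertex set inducing an edgeless graph. The binary chromatic number $\chi_B(G)$ is the least integer $k+1$ such that for every $c\in\{0,\dots,k+1\}$ there is a partition of $V(G)$ into $c$ cliques and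 $k+1-c$ cocliques (parts may be empty). -}

module Defs where

open import Data.Nat using (ℕ; zero; suc; _+_; _*_; _∸_; _^_; _≤_; _<_)
open import Data.Nat.Combinatorics using (_C_)
open import Data.Fin using (Fin; toℕ)
open import Data.Fin.Base using () renaming (zero to fz; suc to fs)
open import Data.Bool using (Bool; true; false; if_then_else_; _xor_)
open import Data.Sum using (_⊎_; inj₁; inj₂)
open import Data.Product using (Σ; _×_; ∃)
open import Relation.Nullary using (¬_)
open import Relation.Binary.PropositionalEquality using (_≡_; _≢_)
open import Function.Definitions using (Injective)

record Graph (n : ℕ) : Set where
  field
    adj  : Fin n → Fin n → Bool
    sym  : ∀ i j → adj i j ≡ adj j i
    irr  : ∀ i → adj i i ≡ false
open Graph public

HasInduced : ∀ {m n} → Graph n → Graph m → Set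
HasInduced {m} {n} G H =
  Σ (Fin m → Fin n) λ f → Injective _≡_ _≡_ f × (∀ i j → adj G (f i) (f j) ≡ adj H i j)

InForb : ∀ {m n} → Graph m → Graph n → Set
InForb H G = ¬ HasInduced G H

sumFin : ∀ n → (Fin n → ℕ) → ℕ
sumFin zero    f = 0
sumFin (suc n) f = f fz + sumFin n (λ i → f (fs i))

symDiff : ∀ {n} → Graph n → Graph n → ℕ
symDiff {n} G G' = sumFin n λ i → sumFin n λ j →
  if toℕ i Data.Nat.<ᵇ toℕ j then (if adj G i j xor adj G' i j then 1 else 0) else 0
  where import Data.Nat

-- "Dist(n, Forb(n,H)) ≤ B" where the bound B is described by a predicate P on
-- naturals (P d means "d ≤ B"): every n-vertex graph G is within some
-- distance d satisfying P of an H-free graph on the same vertex set.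
-- (Forb(n,H) is closed under isomorphism, so minimizing over relabellings is
-- the same as choosing the H-free graph directly on V(G).)
DistForbBound : ∀ {m} → (n : ℕ) → Graph m → (ℕ → Set) → Set
DistForbBound n H P =
  (G : Graph n) → Σ (Graph n) λ G' → InForb H G' × P (symDiff G G')

Partitionable : ∀ {m} → Graph m → ℕ → ℕ → Set
Partitionable {m} H c d =
  Σ (Fin m → Fin c ⊎ Fin d) λ p →
    (∀ u v → u ≢ v → ∀ a → p u ≡ inj₁ a → p v ≡ inj₁ a → adj H u v ≡ true) ×
    (∀ u v → ∀ b → p u ≡ inj₂ b → p v ≡ inj₂ b → adj H u v ≡ false)

BinWorks : ∀ {m} → Graph m → ℕ → Set
BinWorks H t = ∀ c → c ≤ t → Partitionable H c (t ∸ c)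

IsBinChrom : ∀ {m} → Graph m → ℕ → Set
IsBinChrom H t = 1 ≤ t × BinWorks H t × (∀ t' → 1 ≤ t' → t' < t → ¬ BinWorks H t')

IsCmin : ∀ {m} → Graph m → ℕ → ℕ → Set
IsCmin H k cm = cm ≤ k × ¬ Partitionable H cm (k ∸ cm) ×
  (∀ c → c ≤ k → ¬ Partitionable H c (k ∸ c) → cm ≤ c)

IsCmax : ∀ {m} → Graph m → ℕ → ℕ → Set
IsCmax H k cM = cM ≤ k × ¬ Partitionable H cM (k ∸ cM) ×
  (∀ c → c ≤ k → ¬ Partitionable H c (k ∸ c) → c ≤ cM)

Bound1 : ℕ → ℕ → ℕ → Set
Bound1 k n d = 2 * k * d ≤ n C 2

-- d ≤ (1/(1+2√((c/k)(1−c/k)))) (1/k) C(n,2)  and  d ≤ (1/k) C(n,2).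
-- With N = C(n,2): the first is d·(k + 2√(c(k−c))) ≤ N, i.e.
-- k·d ≤ N and 4·d²·c·(k−c) ≤ (N − k·d)² (exact integer rewriting).
Bound2 : ℕ → ℕ → ℕ → ℕ → Set
Bound2 k c n d =
  (k * d ≤ n C 2 × 4 * (d * d) * (c * (k ∸ c)) ≤ (n C 2 ∸ k * d) ^ 2) × k * d ≤ n C 2

-- If V(H) has no partition into C cliques and D cocliques, colour the vertices of G
-- independently, giving each of C clique colours weight x and each of D coclique colours
-- weight y, and make every colour class a clique or a coclique according to its colour: an
-- induced copy of H in the result would be such a partition of H. A pair of vertices is
-- edited only if both ends get the same colour and the pair disagrees with that colour, so
-- on average (C x + D y)² d ≤ C x² ē + D y² e, where G has e edges and ē non-edges.
-- Unit weights, with c = cmin if e ≤ ē and c = cmax otherwise, give 2 k d ≤ e + ē by the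
-- rearrangement inequality. The weights (e, ē) give (C e + D ē) d ≤ e ē; writing
-- e = D d + X and ē = C d + Y this says C D d² ≤ X Y, so by AM-GM
-- d (√C + √D)² = d (k + 2 √(C D)) ≤ e + ē, which is the second bound.

module Submission where

open import Defs hiding (sym)
open import Data.Nat using (ℕ; zero; suc; _+_; _*_; _∸_; _^_; _≤_; _<_; _<ᵇ_; z≤n; s≤s; s≤s⁻¹; NonZero; >-nonZero)
open import Data.Nat.Properties hiding (_≟_)
open import Data.Nat.Combinatorics using (nC1≡n; nCk+nC[k+1]≡[n+1]C[k+1]) renaming (_C_ to _choose_)
open import Data.Nat.Solver using (module +-*-Solver)
open +-*-Solver using (solve; _:+_; _:*_; _:^_; _:=_; con)
open import Data.Bool using (Bool; true; false; not; T; if_then_else_; _xor_)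
open import Data.Bool.Properties using (xor-same; xor-comm; xor-identityʳ)
open import Data.Fin using (Fin; toℕ; splitAt; join; punchIn; _≟_) renaming (zero to fz; suc to fs)
open import Data.Fin.Properties using (punchInᵢ≢i; join-splitAt)
open import Data.Vec.Functional using (_∷_; tail)
open import Data.Sum as Sum using (_⊎_; inj₁; inj₂)
open import Data.Product using (Σ-syntax; ∃; _×_; _,_)
open import Data.Empty using (⊥-elim)
open import Function using (_∘_)
open import Relation.Nullary using (¬_; yes; no; does)
open import Relation.Nullary.Decidable using (dec-true; dec-false)
open import Relation.Binary.PropositionalEquality
open import Algebra.Properties.CommutativeSemigroup *-commutativeSemigroup using (x∙yz≈y∙xz)
open import Algebra.Properties.Semiring.Sum +-*-semiring
  using (sum-syntax; sum-cong-≗; sum-remove; sum-replicate-zero; ∑-distrib-+; ∑-comm; *-distribˡ-sum; *-distribʳ-sum)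

sumFin≡∑ : ∀ n (f : Fin n → ℕ) → sumFin n f ≡ ∑[ i < n ] f i
sumFin≡∑ zero    f = refl
sumFin≡∑ (suc n) f = cong (f fz +_) (sumFin≡∑ n (λ i → f (fs i)))

∑-const : ∀ n c → ∑[ i < n ] c ≡ n * c
∑-const zero    c = refl
∑-const (suc n) c = cong (c +_) (∑-const n c)

∑<∑⇒∃< : ∀ {n} (f g : Fin n → ℕ) → ∑[ i < n ] f i < ∑[ i < n ] g i → ∃ λ i → f i < g i
∑<∑⇒∃< {suc n} f g lt with f fz <? g fz
... | yes f₀<g₀ = fz , f₀<g₀
... | no  f₀≮g₀ =
  let tail< = +-cancelˡ-< (g fz) _ _ (≤-<-trans (+-monoˡ-≤ _ (≮⇒≥ f₀≮g₀)) lt)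
      i , fi<gi = ∑<∑⇒∃< (λ i → f (fs i)) (λ i → g (fs i)) tail<
  in fs i , fi<gi

∑-δ : ∀ {n} (f : Fin n → ℕ) (a : Fin n) → (∀ b → b ≢ a → f b ≡ 0) → ∑[ b < n ] f b ≡ f a
∑-δ {suc n} f a vanish = begin
  ∑[ b < suc n ] f b                          ≡⟨ sum-remove {i = a} f ⟩
  f a + ∑[ j < n ] f (punchIn a j)            ≡⟨ cong (f a +_) (sum-cong-≗ (λ j → vanish _ (punchInᵢ≢i a j))) ⟩
  f a + ∑[ j < n ] 0                          ≡⟨ cong (f a +_) (sum-replicate-zero n) ⟩
  f a + 0                                     ≡⟨ +-identityʳ (f a) ⟩
  f a                                         ∎
  where open ≡-Reasoning

∑-splitAt : ∀ C {D} (F : Fin C ⊎ Fin D → ℕ) →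
  ∑[ a < C + D ] F (splitAt C a) ≡ ∑[ c < C ] F (inj₁ c) + ∑[ d < D ] F (inj₂ d)
∑-splitAt zero    F = refl
∑-splitAt (suc C) F = trans (cong (F (inj₁ fz) +_) (∑-splitAt C (F ∘ Sum.map₁ fs)))
  (sym (+-assoc (F (inj₁ fz)) _ _))

∑-*-factor : ∀ {n} c (f g : Fin n → ℕ) → ∑[ a < n ] (f a * (c * g a)) ≡ c * ∑[ a < n ] (f a * g a)
∑-*-factor c f g = trans (sum-cong-≗ λ a → x∙yz≈y∙xz (f a) c (g a)) (sym (*-distribˡ-sum c (λ a → f a * g a)))

when : Bool → ℕ → ℕ
when b x = if b then x else 0

when-cong : ∀ b {x y} → (T b → x ≡ y) → when b x ≡ when b y
when-cong true  eq = eq _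
when-cong false eq = refl

*-when : ∀ c b x → c * when b x ≡ when b (c * x)
*-when c true  x = refl
*-when c false x = *-zeroʳ c

when-+ : ∀ b x y → when b x + when b y ≡ when b (x + y)
when-+ true  x y = refl
when-+ false x y = refl

pairTerm : ∀ {n} → (Fin n → Fin n → ℕ) → Fin n → Fin n → ℕ
pairTerm f i j = when (toℕ i <ᵇ toℕ j) (f i j)

pairSum : ∀ {n} → (Fin n → Fin n → ℕ) → ℕ
pairSum {n} f = ∑[ i < n ] ∑[ j < n ] pairTerm f i j

𝟙 : Bool → ℕ
𝟙 b = if b then 1 else 0

pairCount : ∀ {n} → (Fin n → Fin n → Bool) → ℕ
pairCount P = pairSum (λ i j → 𝟙 (P i j))

edges nonedges : ∀ {n} → Graph n → ℕ
edges    G = pairCount (adj G)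
nonedges G = pairCount (λ i j → not (adj G i j))

symDiff≡pairCount : ∀ {n} (G G′ : Graph n) → symDiff G G′ ≡ pairCount (λ i j → adj G i j xor adj G′ i j)
symDiff≡pairCount {n} G G′ = trans (sumFin≡∑ n (λ i → sumFin n (pairTerm mismatch i)))
  (sum-cong-≗ λ i → sumFin≡∑ n (pairTerm mismatch i))
  where
  mismatch : Fin n → Fin n → ℕ
  mismatch i j = 𝟙 (adj G i j xor adj G′ i j)

pairSum-cong : ∀ {n} {f g : Fin n → Fin n → ℕ} → (∀ i j → toℕ i < toℕ j → f i j ≡ g i j) → pairSum f ≡ pairSum g
pairSum-cong eq = sum-cong-≗ λ i → sum-cong-≗ λ j → when-cong _ (eq i j ∘ <ᵇ⇒< (toℕ i) (toℕ j))

pairSum-*ˡ : ∀ {n} c (f : Fin n → Fin n → ℕ) → c * pairSum f ≡ pairSum (λ i j → c * f i j)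
pairSum-*ˡ {n} c f = trans (*-distribˡ-sum c (λ i → ∑[ j < n ] pairTerm f i j)) (sum-cong-≗ λ i →
  trans (*-distribˡ-sum c (pairTerm f i)) (sum-cong-≗ λ j → *-when c _ (f i j)))

pairSum-+ : ∀ {n} (f g : Fin n → Fin n → ℕ) → pairSum f + pairSum g ≡ pairSum (λ i j → f i j + g i j)
pairSum-+ {n} f g = trans (sym (∑-distrib-+ (λ i → ∑[ j < n ] pairTerm f i j) (λ i → ∑[ j < n ] pairTerm g i j)))
  (sum-cong-≗ λ i → trans (sym (∑-distrib-+ (pairTerm f i) (pairTerm g i)))
    (sum-cong-≗ λ j → when-+ _ (f i j) (g i j)))

pairSum-1 : ∀ n → pairSum {n} (λ _ _ → 1) ≡ n choose 2
pairSum-1 zero    = refl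
pairSum-1 (suc n) = begin
  ∑[ j < n ] 1 + pairSum {n} (λ _ _ → 1)  ≡⟨ cong₂ _+_ (trans (∑-const n 1) (*-identityʳ n)) (pairSum-1 n) ⟩
  n + n choose 2                          ≡⟨ cong (_+ n choose 2) (sym (nC1≡n n)) ⟩
  n choose 1 + n choose 2                 ≡⟨ nCk+nC[k+1]≡[n+1]C[k+1] n 1 ⟩
  suc n choose 2                          ∎
  where open ≡-Reasoning

pairCount-complement : ∀ {n} (P : Fin n → Fin n → Bool) → pairCount P + pairCount (λ i j → not (P i j)) ≡ n choose 2
pairCount-complement {n} P = begin
  pairCount P + pairCount (λ i j → not (P i j))     ≡⟨ pairSum-+ (λ i j → 𝟙 (P i j)) (λ i j → 𝟙 (not (P i j))) ⟩
  pairSum (λ i j → 𝟙 (P i j) + 𝟙 (not (P i j)))     ≡⟨ pairSum-cong (λ i j _ → 𝟙-not (P i j)) ⟩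
  pairSum {n} (λ _ _ → 1)                           ≡⟨ pairSum-1 n ⟩
  n choose 2                                        ∎
  where
  open ≡-Reasoning
  𝟙-not : ∀ b → 𝟙 b + 𝟙 (not b) ≡ 1
  𝟙-not true  = refl
  𝟙-not false = refl

edges+nonedges : ∀ {n} (G : Graph n) → edges G + nonedges G ≡ n choose 2
edges+nonedges G = pairCount-complement (adj G)

-- Random colourings

module WeightedColourings {k} (w : Fin k → ℕ) where

  S : ℕ
  S = ∑[ a < k ] w a

  -- 𝔼 n F = Σ_σ (Π_i w (σ i)) F σ is S ^ n times the mean of F when the colours σ i are
  -- independent with P(σ i = a) = w a / S; working with it keeps everything in ℕ.
  𝔼 : ∀ n → ((Fin n → Fin k) → ℕ) → ℕ
  𝔼 zero    F = F (λ ())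
  𝔼 (suc n) F = ∑[ a < k ] (w a * 𝔼 n (λ τ → F (a ∷ τ)))

  𝔼-cong : ∀ n {F G : (Fin n → Fin k) → ℕ} → (∀ σ → F σ ≡ G σ) → 𝔼 n F ≡ 𝔼 n G
  𝔼-cong zero    eq = eq _
  𝔼-cong (suc n) eq = sum-cong-≗ λ a → cong (w a *_) (𝔼-cong n λ τ → eq (a ∷ τ))

  𝔼-const : ∀ n c → 𝔼 n (λ _ → c) ≡ S ^ n * c
  𝔼-const zero    c = sym (*-identityˡ c)
  𝔼-const (suc n) c = begin
    ∑[ a < k ] (w a * 𝔼 n (λ _ → c))≡⟨ sum-cong-≗ (λ a → cong (w a *_) (𝔼-const n c)) ⟩
    ∑[ a < k ] (w a * (S ^ n * c))  ≡⟨ sym (*-distribʳ-sum (S ^ n * c) w) ⟩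
    S * (S ^ n * c)                 ≡⟨ sym (*-assoc S (S ^ n) c) ⟩
    S * S ^ n * c                   ∎
    where open ≡-Reasoning

  𝔼-*ˡ : ∀ n c (F : (Fin n → Fin k) → ℕ) → c * 𝔼 n F ≡ 𝔼 n (λ σ → c * F σ)
  𝔼-*ˡ zero    c F = refl
  𝔼-*ˡ (suc n) c F = begin
    c * ∑[ a < k ] (w a * E a)        ≡⟨ sym (∑-*-factor c w E) ⟩
    ∑[ a < k ] (w a * (c * E a))      ≡⟨ sum-cong-≗ (λ a → cong (w a *_) (𝔼-*ˡ n c (λ τ → F (a ∷ τ)))) ⟩
    𝔼 (suc n) (λ σ → c * F σ)         ∎
    where
    open ≡-Reasoning
    E : Fin k → ℕ
    E a = 𝔼 n (λ τ → F (a ∷ τ))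

  𝔼-∑ : ∀ n {m} (F : (Fin n → Fin k) → Fin m → ℕ) →
    𝔼 n (λ σ → ∑[ i < m ] F σ i) ≡ ∑[ i < m ] 𝔼 n (λ σ → F σ i)
  𝔼-∑ zero    F = refl
  𝔼-∑ (suc n) {m} F = begin
    ∑[ a < k ] (w a * 𝔼 n (λ τ → ∑[ i < m ] F (a ∷ τ) i)) ≡⟨ sum-cong-≗ (λ a → cong (w a *_) (𝔼-∑ n (F ∘ (a ∷_)))) ⟩
    ∑[ a < k ] (w a * ∑[ i < m ] E a i)                   ≡⟨ sum-cong-≗ (λ a → *-distribˡ-sum (w a) (E a)) ⟩
    ∑[ a < k ] ∑[ i < m ] (w a * E a i)                   ≡⟨ ∑-comm (λ a i → w a * E a i) ⟩
    ∑[ i < m ] ∑[ a < k ] (w a * E a i)                   ∎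
    where
    open ≡-Reasoning
    E : Fin k → Fin m → ℕ
    E a i = 𝔼 n (λ τ → F (a ∷ τ) i)

  𝔼-when : ∀ n b (F : (Fin n → Fin k) → ℕ) → 𝔼 n (λ σ → when b (F σ)) ≡ when b (𝔼 n F)
  𝔼-when n true  F = refl
  𝔼-when n false F = trans (𝔼-const n 0) (*-zeroʳ (S ^ n))

  𝔼-tail : ∀ n (F : (Fin n → Fin k) → ℕ) → 𝔼 (suc n) (λ σ → F (tail σ)) ≡ S * 𝔼 n F
  𝔼-tail n F = sym (*-distribʳ-sum (𝔼 n F) w)

  𝔼<𝔼⇒∃< : ∀ n (F G : (Fin n → Fin k) → ℕ) → 𝔼 n F < 𝔼 n G → ∃ λ σ → F σ < G σ
  𝔼<𝔼⇒∃< zero    F G lt = _ , lt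
  𝔼<𝔼⇒∃< (suc n) F G lt with ∑<∑⇒∃< _ _ lt
  ... | a , wEa<wGa with 𝔼<𝔼⇒∃< n _ _ (*-cancelˡ-< (w a) _ _ wEa<wGa)
  ...   | τ , Fτ<Gτ = a ∷ τ , Fτ<Gτ

  𝔼-marginal₁ : ∀ n (v : Fin n) (g : Fin k → ℕ) → S * 𝔼 n (λ σ → g (σ v)) ≡ S ^ n * ∑[ a < k ] (w a * g a)
  𝔼-marginal₁ (suc n) fz g = begin
    S * ∑[ a < k ] (w a * 𝔼 n (λ _ → g a))   ≡⟨ cong (S *_) (sum-cong-≗ λ a → cong (w a *_) (𝔼-const n (g a))) ⟩
    S * ∑[ a < k ] (w a * (S ^ n * g a))     ≡⟨ cong (S *_) (∑-*-factor (S ^ n) w g) ⟩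
    S * (S ^ n * ∑[ a < k ] (w a * g a))     ≡⟨ sym (*-assoc S (S ^ n) _) ⟩
    S * S ^ n * ∑[ a < k ] (w a * g a)       ∎
    where open ≡-Reasoning
  𝔼-marginal₁ (suc n) (fs v) g = begin
    S * 𝔼 (suc n) (λ σ → g (tail σ v))       ≡⟨ cong (S *_) (𝔼-tail n (λ τ → g (τ v))) ⟩
    S * (S * 𝔼 n (λ τ → g (τ v)))            ≡⟨ cong (S *_) (𝔼-marginal₁ n v g) ⟩
    S * (S ^ n * ∑[ a < k ] (w a * g a))     ≡⟨ sym (*-assoc S (S ^ n) _) ⟩
    S * S ^ n * ∑[ a < k ] (w a * g a)       ∎
    where open ≡-Reasoning

  ∑∑-flip : (h : Fin k → Fin k → ℕ) →
    ∑[ a < k ] (w a * ∑[ b < k ] (w b * h b a)) ≡ ∑[ a < k ] (w a * ∑[ b < k ] (w b * h a b))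
  ∑∑-flip h = begin
    ∑[ a < k ] (w a * ∑[ b < k ] (w b * h b a))   ≡⟨ sum-cong-≗ (λ a → *-distribˡ-sum (w a) (λ b → w b * h b a)) ⟩
    ∑[ a < k ] ∑[ b < k ] (w a * (w b * h b a))   ≡⟨ ∑-comm (λ a b → w a * (w b * h b a)) ⟩
    ∑[ b < k ] ∑[ a < k ] (w a * (w b * h b a))   ≡⟨ sum-cong-≗ (λ b → ∑-*-factor (w b) w (λ a → h b a)) ⟩
    ∑[ b < k ] (w b * ∑[ a < k ] (w a * h b a))   ∎
    where open ≡-Reasoning

  𝔼-marginal₂ : ∀ n {u v : Fin n} → u ≢ v → (h : Fin k → Fin k → ℕ) →
    S * S * 𝔼 n (λ σ → h (σ u) (σ v)) ≡ S ^ n * ∑[ a < k ] (w a * ∑[ b < k ] (w b * h a b))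
  𝔼-marginal₂ (suc n) {fz} {fz} u≢v h = ⊥-elim (u≢v refl)
  𝔼-marginal₂ (suc n) {fz} {fs v} u≢v h = begin
    S * S * ∑[ a < k ] (w a * E a)                             ≡⟨ *-assoc S S _ ⟩
    S * (S * ∑[ a < k ] (w a * E a))                           ≡⟨ cong (S *_) (sym (∑-*-factor S w E)) ⟩
    S * ∑[ a < k ] (w a * (S * E a))                           ≡⟨ cong (S *_) (sum-cong-≗ λ a →
                                                                    cong (w a *_) (𝔼-marginal₁ n v (h a))) ⟩
    S * ∑[ a < k ] (w a * (S ^ n * ∑[ b < k ] (w b * h a b)))  ≡⟨ cong (S *_) (∑-*-factor (S ^ n) w _) ⟩
    S * (S ^ n * M)                                            ≡⟨ sym (*-assoc S (S ^ n) M) ⟩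
    S * S ^ n * M                                              ∎
    where
    open ≡-Reasoning
    E : Fin k → ℕ
    E a = 𝔼 n (λ τ → h a (τ v))
    M : ℕ
    M = ∑[ a < k ] (w a * ∑[ b < k ] (w b * h a b))
  𝔼-marginal₂ (suc n) {fs u} {fz} u≢v h =
    trans (𝔼-marginal₂ (suc n) {fz} {fs u} (u≢v ∘ sym) (λ a b → h b a)) (cong (S ^ suc n *_) (∑∑-flip h))
  𝔼-marginal₂ (suc n) {fs u} {fs v} u≢v h = begin
    S * S * 𝔼 (suc n) (λ σ → h (tail σ u) (tail σ v))   ≡⟨ cong (S * S *_) (𝔼-tail n (λ τ → h (τ u) (τ v))) ⟩
    S * S * (S * E)                                     ≡⟨ x∙yz≈y∙xz (S * S) S E ⟩
    S * (S * S * E)                                     ≡⟨ cong (S *_) (𝔼-marginal₂ n (u≢v ∘ cong fs) h) ⟩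
    S * (S ^ n * M)                                     ≡⟨ sym (*-assoc S (S ^ n) M) ⟩
    S * S ^ n * M                                       ∎
    where
    open ≡-Reasoning
    E M : ℕ
    E = 𝔼 n (λ τ → h (τ u) (τ v))
    M = ∑[ a < k ] (w a * ∑[ b < k ] (w b * h a b))

  𝔼-pairSum : ∀ n (F : (Fin n → Fin k) → Fin n → Fin n → ℕ) →
    𝔼 n (λ σ → pairSum (F σ)) ≡ pairSum (λ i j → 𝔼 n (λ σ → F σ i j))
  𝔼-pairSum n F = trans (𝔼-∑ n λ σ i → ∑[ j < n ] pairTerm (F σ) i j) (sum-cong-≗ λ i →
    trans (𝔼-∑ n λ σ → pairTerm (F σ) i) (sum-cong-≗ λ j → 𝔼-when n _ (λ σ → F σ i j)))

  𝔼-pairs : ∀ n (h : Fin n → Fin n → Fin k → Fin k → ℕ) →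
    S * S * 𝔼 n (λ σ → pairSum (λ i j → h i j (σ i) (σ j))) ≡
    S ^ n * pairSum (λ i j → ∑[ a < k ] (w a * ∑[ b < k ] (w b * h i j a b)))
  𝔼-pairs n h = begin
    S * S * 𝔼 n (λ σ → pairSum (λ i j → h i j (σ i) (σ j)))    ≡⟨ cong (S * S *_) (𝔼-pairSum n λ σ i j → h i j (σ i) (σ j)) ⟩
    S * S * pairSum E                                          ≡⟨ pairSum-*ˡ (S * S) E ⟩
    pairSum (λ i j → S * S * E i j)                            ≡⟨ pairSum-cong (λ i j i<j →
                                                                    𝔼-marginal₂ n (<⇒≢ i<j ∘ cong toℕ) (h i j)) ⟩
    pairSum (λ i j → S ^ n * M i j)                            ≡⟨ sym (pairSum-*ˡ (S ^ n) M) ⟩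
    S ^ n * pairSum M                                          ∎
    where
    open ≡-Reasoning
    E M : Fin n → Fin n → ℕ
    E i j = 𝔼 n (λ σ → h i j (σ i) (σ j))
    M i j = ∑[ a < k ] (w a * ∑[ b < k ] (w b * h i j a b))

  𝔼≤⇒∃≤ : 0 < S → ∀ n (F : (Fin n → Fin k) → ℕ) c → 𝔼 n F ≤ S ^ n * c → ∃ λ σ → F σ ≤ c
  𝔼≤⇒∃≤ 0<S n F c 𝔼F≤ with 𝔼<𝔼⇒∃< n F (λ _ → suc c) 𝔼F<
    where
    𝔼F< : 𝔼 n F < 𝔼 n (λ _ → suc c)
    𝔼F< = begin-strict
      𝔼 n F                 ≤⟨ 𝔼F≤ ⟩
      S ^ n * c             <⟨ m<n+m _ (m^n>0 S {{>-nonZero 0<S}} n) ⟩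
      S ^ n + S ^ n * c     ≡⟨ sym (*-suc (S ^ n) c) ⟩
      S ^ n * suc c         ≡⟨ sym (𝔼-const n (suc c)) ⟩
      𝔼 n (λ _ → suc c)     ∎
      where open ≤-Reasoning
  ... | σ , Fσ<1+c = σ , s≤s⁻¹ Fσ<1+c

-- Cleaning along a colouring

module _ {n k} (G : Graph n) (t : Fin k → Bool) where

  cleanAdj : Fin n → Fin n → Fin k → Fin k → Bool
  cleanAdj i j a b = if does (i ≟ j) then false else if does (a ≟ b) then t a else adj G i j

  cleanAdj-sym : ∀ i j a b → cleanAdj i j a b ≡ cleanAdj j i b a
  cleanAdj-sym i j a b with i ≟ j
  ... | yes refl rewrite dec-true (i ≟ i) refl = refl
  ... | no i≢j rewrite dec-false (j ≟ i) (i≢j ∘ sym) with a ≟ b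
  ...   | yes refl rewrite dec-true (a ≟ a) refl = refl
  ...   | no a≢b rewrite dec-false (b ≟ a) (a≢b ∘ sym) = Graph.sym G i j

  cleanAdj-irr : ∀ i a b → cleanAdj i i a b ≡ false
  cleanAdj-irr i a b rewrite dec-true (i ≟ i) refl = refl

  cleanAdj-same : ∀ {i j} → i ≢ j → ∀ a → cleanAdj i j a a ≡ t a
  cleanAdj-same {i} {j} i≢j a rewrite dec-false (i ≟ j) i≢j | dec-true (a ≟ a) refl = refl

  cleanAdj-diff : ∀ {i j a b} → i ≢ j → a ≢ b → cleanAdj i j a b ≡ adj G i j
  cleanAdj-diff {i} {j} {a} {b} i≢j a≢b rewrite dec-false (i ≟ j) i≢j | dec-false (a ≟ b) a≢b = refl

  clean : (Fin n → Fin k) → Graph n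
  clean σ = record
    { adj = λ i j → cleanAdj i j (σ i) (σ j)
    ; sym = λ i j → cleanAdj-sym i j (σ i) (σ j)
    ; irr = λ i → cleanAdj-irr i (σ i) (σ i)
    }

  cleanAdj-pairWeight : (w : Fin k → ℕ) {i j : Fin n} → i ≢ j →
    ∑[ a < k ] (w a * ∑[ b < k ] (w b * 𝟙 (adj G i j xor cleanAdj i j a b))) ≡
    ∑[ a < k ] (w a * (w a * 𝟙 (adj G i j xor t a)))
  cleanAdj-pairWeight w {i} {j} i≢j = sum-cong-≗ λ a → cong (w a *_) (trans
    (∑-δ (λ b → w b * 𝟙 (adj G i j xor cleanAdj i j a b)) a (vanish a))
    (cong (λ z → w a * 𝟙 (adj G i j xor z)) (cleanAdj-same i≢j a)))
    where
    vanish : ∀ a b → b ≢ a → w b * 𝟙 (adj G i j xor cleanAdj i j a b) ≡ 0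
    vanish a b b≢a rewrite cleanAdj-diff i≢j (b≢a ∘ sym) | xor-same (adj G i j) = *-zeroʳ (w b)

splitAt-injective : ∀ m {n} {a b : Fin (m + n)} → splitAt m a ≡ splitAt m b → a ≡ b
splitAt-injective m {n} {a} {b} eq =
  trans (sym (join-splitAt m n a)) (trans (cong (join m n) eq) (join-splitAt m n b))

module _ {C D : ℕ} where

  clique? : Fin C ⊎ Fin D → Bool
  clique? (inj₁ _) = true
  clique? (inj₂ _) = false

  cliqueColour : Fin (C + D) → Bool
  cliqueColour = clique? ∘ splitAt C

  clean-InForb : ∀ {m n} {H : Graph m} → ¬ Partitionable H C D →
    (G : Graph n) (σ : Fin n → Fin (C + D)) → InForb H (clean G cliqueColour σ)
  clean-InForb {m} {H = H} ¬P G σ (f , f-injective , f-induced) = ¬P (part , cliques , cocliques)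
    where
    part : Fin m → Fin C ⊎ Fin D
    part u = splitAt C (σ (f u))

    same-part : ∀ {u v} → u ≢ v → part u ≡ part v → adj H u v ≡ clique? (part u)
    same-part {u} {v} u≢v pu≡pv = begin
      adj H u v                                                   ≡⟨ sym (f-induced u v) ⟩
      cleanAdj G cliqueColour (f u) (f v) (σ (f u)) (σ (f v))     ≡⟨ cong (cleanAdj G cliqueColour (f u) (f v) (σ (f u)))
                                                                           (splitAt-injective C (sym pu≡pv)) ⟩
      cleanAdj G cliqueColour (f u) (f v) (σ (f u)) (σ (f u))     ≡⟨ cleanAdj-same G cliqueColour (u≢v ∘ f-injective) _ ⟩
      clique? (part u)                                            ∎
      where open ≡-Reasoning

    cliques : ∀ u v → u ≢ v → ∀ a → part u ≡ inj₁ a → part v ≡ inj₁ a → adj H u v ≡ true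
    cliques u v u≢v a pu pv = trans (same-part u≢v (trans pu (sym pv))) (cong clique? pu)

    cocliques : ∀ u v b → part u ≡ inj₂ b → part v ≡ inj₂ b → adj H u v ≡ false
    cocliques u v b pu pv with u ≟ v
    ... | yes refl = irr H u
    ... | no u≢v   = trans (same-part u≢v (trans pu (sym pv))) (cong clique? pu)

  module _ (x y : ℕ) where

    weight : Fin C ⊎ Fin D → ℕ
    weight (inj₁ _) = x
    weight (inj₂ _) = y

    colourWeight : Fin (C + D) → ℕ
    colourWeight = weight ∘ splitAt C

    ∑-colourWeight : ∑[ a < C + D ] colourWeight a ≡ C * x + D * y
    ∑-colourWeight = trans (∑-splitAt C weight) (cong₂ _+_ (∑-const C x) (∑-const D y))

    ∑-colourWeight²-mismatch : ∀ β →
      ∑[ a < C + D ] (colourWeight a * (colourWeight a * 𝟙 (β xor cliqueColour a))) ≡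
      C * (x * x) * 𝟙 (not β) + D * (y * y) * 𝟙 β
    ∑-colourWeight²-mismatch β = begin
      ∑[ a < C + D ] F (splitAt C a)                                            ≡⟨ ∑-splitAt C F ⟩
      ∑[ c < C ] (x * (x * 𝟙 (β xor true))) + ∑[ d < D ] (y * (y * 𝟙 (β xor false)))
                                                                                ≡⟨ cong₂ _+_ (∑-const C _) (∑-const D _) ⟩
      C * (x * (x * 𝟙 (β xor true))) + D * (y * (y * 𝟙 (β xor false)))         ≡⟨ cong₂ _+_ (reassoc C x (xor-comm β true))
                                                                                                 (reassoc D y (xor-identityʳ β)) ⟩
      C * (x * x) * 𝟙 (not β) + D * (y * y) * 𝟙 β                              ∎
      where
      open ≡-Reasoning
      F : Fin C ⊎ Fin D → ℕ
      F s = weight s * (weight s * 𝟙 (β xor clique? s))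
      reassoc : ∀ p q {b b′} → b ≡ b′ → p * (q * (q * 𝟙 b)) ≡ p * (q * q) * 𝟙 b′
      reassoc p q {b} refl = trans (cong (p *_) (sym (*-assoc q q (𝟙 b)))) (sym (*-assoc p (q * q) (𝟙 b)))

    module _ {n} (G : Graph n) where
      open WeightedColourings colourWeight

      𝔼-symDiff-clean : S * S * 𝔼 n (λ σ → symDiff G (clean G cliqueColour σ)) ≡
        S ^ n * (C * (x * x) * nonedges G + D * (y * y) * edges G)
      𝔼-symDiff-clean = begin
        S * S * 𝔼 n (λ σ → symDiff G (clean G cliqueColour σ))
          ≡⟨ cong (S * S *_) (𝔼-cong n (λ σ → symDiff≡pairCount G (clean G cliqueColour σ))) ⟩
        S * S * 𝔼 n (λ σ → pairSum (λ i j → mismatch i j (σ i) (σ j)))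
          ≡⟨ 𝔼-pairs n mismatch ⟩
        S ^ n * pairSum (λ i j → ∑[ a < C + D ] (colourWeight a * ∑[ b < C + D ] (colourWeight b * mismatch i j a b)))
          ≡⟨ cong (S ^ n *_) (pairSum-cong λ i j i<j →
               trans (cleanAdj-pairWeight G cliqueColour colourWeight (<⇒≢ i<j ∘ cong toℕ))
                     (∑-colourWeight²-mismatch (adj G i j))) ⟩
        S ^ n * pairSum (λ i j → p * non i j + q * ed i j)
          ≡⟨ cong (S ^ n *_) (sym (pairSum-+ (λ i j → p * non i j) (λ i j → q * ed i j))) ⟩
        S ^ n * (pairSum (λ i j → p * non i j) + pairSum (λ i j → q * ed i j))
          ≡⟨ cong (S ^ n *_) (sym (cong₂ _+_ (pairSum-*ˡ p non) (pairSum-*ˡ q ed))) ⟩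
        S ^ n * (p * nonedges G + q * edges G)
          ∎
        where
        open ≡-Reasoning
        mismatch : Fin n → Fin n → Fin (C + D) → Fin (C + D) → ℕ
        mismatch i j a b = 𝟙 (adj G i j xor cleanAdj G cliqueColour i j a b)
        p q : ℕ
        p = C * (x * x)
        q = D * (y * y)
        non ed : Fin n → Fin n → ℕ
        non i j = 𝟙 (not (adj G i j))
        ed  i j = 𝟙 (adj G i j)

cleaning-bound : ∀ {m n C D} {H : Graph m} → ¬ Partitionable H C D → (G : Graph n) (x y : ℕ) → 0 < C * x + D * y →
  Σ[ G′ ∈ Graph n ] InForb H G′ ×
    (C * x + D * y) * (C * x + D * y) * symDiff G G′ ≤ C * (x * x) * nonedges G + D * (y * y) * edges G
cleaning-bound {n = n} {C} {D} {H} ¬P G x y 0<Cx+Dy = conclude (𝔼≤⇒∃≤ 0<S n (λ σ → S * S * distance σ) R 𝔼≤)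
  where
  open WeightedColourings (colourWeight {C} {D} x y)
  R : ℕ
  R = C * (x * x) * nonedges G + D * (y * y) * edges G
  0<S : 0 < S
  0<S = subst (0 <_) (sym (∑-colourWeight {C} {D} x y)) 0<Cx+Dy
  clean-σ : (Fin n → Fin (C + D)) → Graph n
  clean-σ = clean G (cliqueColour {C} {D})
  distance : (Fin n → Fin (C + D)) → ℕ
  distance σ = symDiff G (clean-σ σ)
  𝔼≤ : 𝔼 n (λ σ → S * S * distance σ) ≤ S ^ n * R
  𝔼≤ = ≤-reflexive (trans (sym (𝔼-*ˡ n (S * S) distance)) (𝔼-symDiff-clean {C} {D} x y G))
  conclude : ∃ (λ σ → S * S * distance σ ≤ R) →
    Σ[ G′ ∈ Graph n ] InForb H G′ × (C * x + D * y) * (C * x + D * y) * symDiff G G′ ≤ R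
  conclude (σ , bound) =
    clean-σ σ , clean-InForb {C} {D} {H = H} ¬P G σ , subst (λ s → s * s * distance σ ≤ R) (∑-colourWeight {C} {D} x y) bound

unit-cleaning-bound : ∀ {m n C D} {H : Graph m} → ¬ Partitionable H C D → 0 < C + D → (G : Graph n) →
  Σ[ G′ ∈ Graph n ] InForb H G′ × (C + D) * (C + D) * symDiff G G′ ≤ C * nonedges G + D * edges G
unit-cleaning-bound {C = C} {D} {H} ¬P 0<k G =
  let G′ , H-free , bound = cleaning-bound {C = C} {D} {H} ¬P G 1 1 (subst (0 <_) (sym unit-sum) 0<k)
  in G′ , H-free , subst₂ (λ k R → k * k * symDiff G G′ ≤ R) unit-sum unit-weights bound
  where
  unit-sum : C * 1 + D * 1 ≡ C + D
  unit-sum = cong₂ _+_ (*-identityʳ C) (*-identityʳ D)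
  unit-weights : C * (1 * 1) * nonedges G + D * (1 * 1) * edges G ≡ C * nonedges G + D * edges G
  unit-weights = cong₂ (λ p q → p * nonedges G + q * edges G) (*-identityʳ C) (*-identityʳ D)

rearrangement : ∀ {C D e ē} → (C ≤ D × e ≤ ē) ⊎ (D ≤ C × ē ≤ e) → 2 * (C * ē + D * e) ≤ (C + D) * (e + ē)
rearrangement (inj₁ (C≤D , e≤ē)) = sorted C≤D e≤ē
  where
  sorted : ∀ {C D e ē} → C ≤ D → e ≤ ē → 2 * (C * ē + D * e) ≤ (C + D) * (e + ē)
  sorted {C} {e = e} C≤D e≤ē with m≤n⇒∃[o]m+o≡n C≤D | m≤n⇒∃[o]m+o≡n e≤ē
  ... | s , refl | t , refl = subst (2 * (C * (e + t) + (C + s) * e) ≤_)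
    (solve 4 (λ C s e t → con 2 :* (C :* (e :+ t) :+ (C :+ s) :* e) :+ s :* t := (C :+ (C :+ s)) :* (e :+ (e :+ t))) refl C s e t)
    (m≤m+n _ (s * t))
rearrangement {C} {D} {e} {ē} (inj₂ (D≤C , ē≤e)) =
  subst₂ _≤_ (cong (2 *_) (+-comm (D * e) (C * ē))) (cong₂ _*_ (+-comm D C) (+-comm ē e))
    (rearrangement (inj₁ (D≤C , ē≤e)))

unit-weight-2kd≤N : ∀ {C D e ē d} → 0 < C + D → (C ≤ D × e ≤ ē) ⊎ (D ≤ C × ē ≤ e) →
  (C + D) * (C + D) * d ≤ C * ē + D * e → 2 * (C + D) * d ≤ e + ē
unit-weight-2kd≤N {C} {D} {e} {ē} {d} 0<k sorted h = *-cancelˡ-≤ (C + D) {{>-nonZero 0<k}} (begin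
  (C + D) * (2 * (C + D) * d)   ≡⟨ solve 2 (λ k d → k :* (con 2 :* k :* d) := con 2 :* (k :* k :* d)) refl (C + D) d ⟩
  2 * ((C + D) * (C + D) * d)   ≤⟨ *-monoʳ-≤ 2 h ⟩
  2 * (C * ē + D * e)           ≤⟨ rearrangement sorted ⟩
  (C + D) * (e + ē)             ∎)
  where open ≤-Reasoning

-- d (√C + √D)² ≤ N, with the irrational term isolated and squared.
RootBound : ℕ → ℕ → ℕ → ℕ → Set
RootBound C D N d = (C + D) * d ≤ N × 4 * (d * d) * (C * D) ≤ (N ∸ (C + D) * d) ^ 2

RootBound-zero : ∀ C D N → RootBound C D N 0
RootBound-zero C D N = subst (_≤ N) (sym (*-zeroʳ (C + D))) z≤n , z≤n

4xy≤[x+y]² : ∀ x y → 4 * (x * y) ≤ (x + y) ^ 2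
4xy≤[x+y]² x y = Sum.[ sorted , sorted-flipped ]′ (≤-total x y)
  where
  sorted : ∀ {x y} → x ≤ y → 4 * (x * y) ≤ (x + y) ^ 2
  sorted {x} x≤y with m≤n⇒∃[o]m+o≡n x≤y
  ... | t , refl = subst (4 * (x * (x + t)) ≤_)
    (solve 2 (λ x t → con 4 :* (x :* (x :+ t)) :+ t :* t := (x :+ (x :+ t)) :^ 2) refl x t)
    (m≤m+n _ (t * t))
  sorted-flipped : y ≤ x → 4 * (x * y) ≤ (x + y) ^ 2
  sorted-flipped y≤x = subst₂ (λ p s → 4 * p ≤ s ^ 2) (*-comm y x) (+-comm y x) (sorted y≤x)

RootBound-of-slack : ∀ C D X Y d → C * D * (d * d) ≤ X * Y → RootBound C D ((D * d + X) + (C * d + Y)) d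
RootBound-of-slack C D X Y d CDd²≤XY = subst (λ N → RootBound C D N d) (sym split) (kd≤N , squares)
  where
  split : (D * d + X) + (C * d + Y) ≡ (C + D) * d + (X + Y)
  split = solve 5 (λ C D X Y d → (D :* d :+ X) :+ (C :* d :+ Y) := (C :+ D) :* d :+ (X :+ Y)) refl C D X Y d
  kd≤N : (C + D) * d ≤ (C + D) * d + (X + Y)
  kd≤N = m≤m+n _ _
  squares : 4 * (d * d) * (C * D) ≤ ((C + D) * d + (X + Y) ∸ (C + D) * d) ^ 2
  squares = begin
    4 * (d * d) * (C * D)   ≡⟨ solve 3 (λ C D d → con 4 :* (d :* d) :* (C :* D) := con 4 :* (C :* D :* (d :* d))) refl C D d ⟩
    4 * (C * D * (d * d))   ≤⟨ *-monoʳ-≤ 4 CDd²≤XY ⟩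
    4 * (X * Y)             ≤⟨ 4xy≤[x+y]² X Y ⟩
    (X + Y) ^ 2             ≡⟨ cong (_^ 2) (sym (m+n∸m≡n ((C + D) * d) (X + Y))) ⟩
    ((C + D) * d + (X + Y) ∸ (C + D) * d) ^ 2 ∎
    where open ≤-Reasoning

S²d≤⇒Sd≤eē : ∀ {C D e ē d} → 0 < C * e + D * ē →
  (C * e + D * ē) * (C * e + D * ē) * d ≤ C * (e * e) * ē + D * (ē * ē) * e → (C * e + D * ē) * d ≤ e * ē
S²d≤⇒Sd≤eē {C} {D} {e} {ē} {d} 0<S h = *-cancelˡ-≤ S {{>-nonZero 0<S}} (begin
  S * (S * d)                         ≡⟨ sym (*-assoc S S d) ⟩
  S * S * d                           ≤⟨ h ⟩
  C * (e * e) * ē + D * (ē * ē) * e   ≡⟨ solve 4 (λ C D e ē → C :* (e :* e) :* ē :+ D :* (ē :* ē) :* e :=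
                                                   (C :* e :+ D :* ē) :* (e :* ē)) refl C D e ē ⟩
  S * (e * ē)                         ∎)
  where
  open ≤-Reasoning
  S : ℕ
  S = C * e + D * ē

RootBound-of-product : ∀ {C D e ē} d → 0 < C * e + D * ē → (C * e + D * ē) * d ≤ e * ē → RootBound C D (e + ē) d
RootBound-of-product {C} {D} {e} {ē} zero 0<S h = RootBound-zero C D (e + ē)
RootBound-of-product {C} {D} {e} {ē} d@(suc _) 0<S h
  with m≤n⇒∃[o]m+o≡n Dd≤e | m≤n⇒∃[o]m+o≡n Cd≤ē
  where
  0<eē : 0 < e * ē
  0<eē = ≤-trans (*-mono-≤ 0<S (s≤s z≤n)) h
  instance
    e≢0 : NonZero e
    e≢0 = m*n≢0⇒m≢0 e {{>-nonZero 0<eē}}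
    ē≢0 : NonZero ē
    ē≢0 = m*n≢0⇒n≢0 e {{>-nonZero 0<eē}}
  Sd≡ : (C * e + D * ē) * d ≡ C * d * e + D * d * ē
  Sd≡ = solve 5 (λ C D e ē d → (C :* e :+ D :* ē) :* d := C :* d :* e :+ D :* d :* ē) refl C D e ē d
  Dd≤e : D * d ≤ e
  Dd≤e = *-cancelʳ-≤ (D * d) e ē (≤-trans (subst (D * d * ē ≤_) (sym Sd≡) (m≤n+m _ _)) h)
  Cd≤ē : C * d ≤ ē
  Cd≤ē = *-cancelʳ-≤ (C * d) ē e
    (≤-trans (subst (C * d * e ≤_) (sym Sd≡) (m≤m+n _ _)) (≤-trans h (≤-reflexive (*-comm e ē))))
... | X , refl | Y , refl = RootBound-of-slack C D X Y d (+-cancelˡ-≤ Z _ _ (subst₂ _≤_ lhs rhs h))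
  where
  Z : ℕ
  Z = C * X * d + D * Y * d + C * D * (d * d)
  lhs : (C * (D * d + X) + D * (C * d + Y)) * d ≡ Z + C * D * (d * d)
  lhs = solve 5 (λ C D X Y d → (C :* (D :* d :+ X) :+ D :* (C :* d :+ Y)) :* d :=
    (C :* X :* d :+ D :* Y :* d :+ C :* D :* (d :* d)) :+ C :* D :* (d :* d)) refl C D X Y d
  rhs : (D * d + X) * (C * d + Y) ≡ Z + X * Y
  rhs = solve 5 (λ C D X Y d → (D :* d :+ X) :* (C :* d :+ Y) :=
    (C :* X :* d :+ D :* Y :* d :+ C :* D :* (d :* d)) :+ X :* Y) refl C D X Y d

unit-weight-kd≤N : ∀ {C D e ē d} → 0 < C + D → (C + D) * (C + D) * d ≤ C * ē + D * e → (C + D) * d ≤ e + ē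
unit-weight-kd≤N {C} {D} {e} {ē} {d} 0<k h = *-cancelˡ-≤ (C + D) {{>-nonZero 0<k}} (begin
  (C + D) * ((C + D) * d)     ≡⟨ sym (*-assoc (C + D) (C + D) d) ⟩
  (C + D) * (C + D) * d       ≤⟨ h ⟩
  C * ē + D * e               ≤⟨ +-mono-≤ (*-monoʳ-≤ C (m≤n+m ē e)) (*-monoʳ-≤ D (m≤m+n e ē)) ⟩
  C * (e + ē) + D * (e + ē)   ≡⟨ sym (*-distribʳ-+ (e + ē) C D) ⟩
  (C + D) * (e + ē)           ∎)
  where open ≤-Reasoning

degenerate⇒CDd≡0 : ∀ C D {e ē d} → C * e + D * ē ≡ 0 → (C + D) * d ≤ e + ē → C * D * d ≡ 0
degenerate⇒CDd≡0 zero    D       S≡0 kd≤N = refl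
degenerate⇒CDd≡0 (suc C) zero {d = d} S≡0 kd≤N = cong (_* d) (*-zeroʳ (suc C))
degenerate⇒CDd≡0 (suc C) (suc D) {e} {ē} {d} S≡0 kd≤N = trans (cong (suc C * suc D *_) d≡0) (*-zeroʳ (suc C * suc D))
  where
  e≡0 : e ≡ 0
  e≡0 = m*n≡0⇒m≡0 e (suc C) (trans (*-comm e (suc C)) (m+n≡0⇒m≡0 (suc C * e) S≡0))
  ē≡0 : ē ≡ 0
  ē≡0 = m*n≡0⇒m≡0 ē (suc D) (trans (*-comm ē (suc D)) (m+n≡0⇒n≡0 (suc C * e) S≡0))
  d≡0 : d ≡ 0
  d≡0 = m*n≡0⇒m≡0 d (suc C + suc D)
    (trans (*-comm d _) (n≤0⇒n≡0 (subst ((suc C + suc D) * d ≤_) (cong₂ _+_ e≡0 ē≡0) kd≤N)))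

RootBound-degenerate : ∀ {C D e ē d} → 0 < C + D → C * e + D * ē ≡ 0 →
  (C + D) * (C + D) * d ≤ C * ē + D * e → RootBound C D (e + ē) d
RootBound-degenerate {C} {D} {e} {ē} {d} 0<k S≡0 h = kd≤N , subst (_≤ (e + ē ∸ (C + D) * d) ^ 2) (sym vanish) z≤n
  where
  kd≤N : (C + D) * d ≤ e + ē
  kd≤N = unit-weight-kd≤N {C} {D} 0<k h
  vanish : 4 * (d * d) * (C * D) ≡ 0
  vanish = begin
    4 * (d * d) * (C * D)   ≡⟨ solve 3 (λ C D d → con 4 :* (d :* d) :* (C :* D) := con 4 :* d :* (C :* D :* d)) refl C D d ⟩
    4 * d * (C * D * d)     ≡⟨ cong (4 * d *_) (degenerate⇒CDd≡0 C D S≡0 kd≤N) ⟩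
    4 * d * 0               ≡⟨ *-zeroʳ (4 * d) ⟩
    0                       ∎
    where open ≡-Reasoning

-- Distance to Forb(n, H)

cleaning-RootBound : ∀ {m n C D} {H : Graph m} → ¬ Partitionable H C D → 0 < C + D → (G : Graph n) →
  Σ[ G′ ∈ Graph n ] InForb H G′ × RootBound C D (edges G + nonedges G) (symDiff G G′)
cleaning-RootBound {C = C} {D} {H} ¬P 0<k G with 0 <? C * edges G + D * nonedges G
... | yes 0<S =
  let G′ , H-free , bound = cleaning-bound {C = C} {D} {H} ¬P G (edges G) (nonedges G) 0<S
  in G′ , H-free , RootBound-of-product {C} {D} (symDiff G G′) 0<S (S²d≤⇒Sd≤eē {C} {D} 0<S bound)
-- The weights (e, ē) vanish when C e + D ē = 0; then unit weights suffice.
... | no S≯0 =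
  let G′ , H-free , bound = unit-cleaning-bound {C = C} {D} {H} ¬P 0<k G
  in G′ , H-free , RootBound-degenerate {C} {D} 0<k (n≤0⇒n≡0 (≮⇒≥ S≯0)) bound

2*m≤n⇒m≤n∸m : ∀ {m n} → 2 * m ≤ n → m ≤ n ∸ m
2*m≤n⇒m≤n∸m {m} {n} 2m≤n = m+n≤o⇒m≤o∸n m (subst (_≤ n) (cong (m +_) (+-identityʳ m)) 2m≤n)

n≤2*m⇒n∸m≤m : ∀ {m n} → n ≤ 2 * m → n ∸ m ≤ m
n≤2*m⇒n∸m≤m {m} {n} n≤2m = m≤n+o⇒m∸n≤o n m (subst (n ≤_) (cong (m +_) (+-identityʳ m)) n≤2m)

0<m+[n∸m] : ∀ {m n} → m ≤ n → 0 < n → 0 < m + (n ∸ m)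
0<m+[n∸m] m≤n 0<n = subst (0 <_) (sym (m+[n∸m]≡n m≤n)) 0<n

sorted-Bound1 : ∀ {m} {H : Graph m} {k c n} → 1 ≤ k → c ≤ k → ¬ Partitionable H c (k ∸ c) → (G : Graph n) →
  (c ≤ k ∸ c × edges G ≤ nonedges G) ⊎ (k ∸ c ≤ c × nonedges G ≤ edges G) →
  Σ[ G′ ∈ Graph n ] InForb H G′ × Bound1 k n (symDiff G G′)
sorted-Bound1 {H = H} {k} {c} 1≤k c≤k ¬P G sorted =
  let G′ , H-free , bound = unit-cleaning-bound {C = c} {k ∸ c} {H} ¬P (0<m+[n∸m] c≤k 1≤k) G
  in G′ , H-free , subst₂ (λ K N → 2 * K * symDiff G G′ ≤ N) (m+[n∸m]≡n c≤k) (edges+nonedges G)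
                     (unit-weight-2kd≤N (0<m+[n∸m] c≤k 1≤k) sorted bound)

DistForbBound-Bound1 : ∀ {m} {H : Graph m} {k cmin cmax} n → 1 ≤ k →
  cmin ≤ k → ¬ Partitionable H cmin (k ∸ cmin) → 2 * cmin ≤ k →
  cmax ≤ k → ¬ Partitionable H cmax (k ∸ cmax) → k ≤ 2 * cmax → DistForbBound n H (Bound1 k n)
DistForbBound-Bound1 {H = H} n 1≤k cmin≤k ¬Pmin 2cmin≤k cmax≤k ¬Pmax k≤2cmax G with edges G ≤? nonedges G
... | yes e≤ē = sorted-Bound1 {H = H} 1≤k cmin≤k ¬Pmin G (inj₁ (2*m≤n⇒m≤n∸m 2cmin≤k , e≤ē))
... | no  e≰ē = sorted-Bound1 {H = H} 1≤k cmax≤k ¬Pmax G (inj₂ (n≤2*m⇒n∸m≤m k≤2cmax , ≰⇒≥ e≰ē))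

DistForbBound-Bound2 : ∀ {m} {H : Graph m} {k c} n → 1 ≤ k → c ≤ k → ¬ Partitionable H c (k ∸ c) →
  DistForbBound n H (Bound2 k c n)
DistForbBound-Bound2 {H = H} {k} {c} n 1≤k c≤k ¬P G =
  let G′ , H-free , bound = cleaning-RootBound {C = c} {k ∸ c} {H} ¬P (0<m+[n∸m] c≤k 1≤k) G
      kd≤N , squares = subst₂ (λ K N → RootBound′ K N (symDiff G G′)) (m+[n∸m]≡n c≤k) (edges+nonedges G) bound
  in G′ , H-free , (kd≤N , squares) , kd≤N
  where
  RootBound′ : ℕ → ℕ → ℕ → Set
  RootBound′ K N d = K * d ≤ N × 4 * (d * d) * (c * (k ∸ c)) ≤ (N ∸ K * d) ^ 2

theorem1p3 : ∀ {m} (H : Graph m) (k cmin cmax : ℕ) → 1 ≤ k → IsBinChrom H (suc k) → IsCmin H k cmin → IsCmax H k cmax → (n : ℕ) →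
    ((2 * cmin ≤ k → k ≤ 2 * cmax → DistForbBound n H (Bound1 k n)) ×
     (k < 2 * cmin → DistForbBound n H (Bound2 k cmin n)) ×
     (2 * cmax < k → DistForbBound n H (Bound2 k cmax n)))
theorem1p3 H k cmin cmax 1≤k _ (cmin≤k , ¬Pmin , _) (cmax≤k , ¬Pmax , _) n =
    (λ 2cmin≤k k≤2cmax → DistForbBound-Bound1 {H = H} n 1≤k cmin≤k ¬Pmin 2cmin≤k cmax≤k ¬Pmax k≤2cmax)
  , (λ _ → DistForbBound-Bound2 {H = H} n 1≤k cmin≤k ¬Pmin)
  , (λ _ → DistForbBound-Bound2 {H = H} n 1≤k cmax≤k ¬Pmax)
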